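{- Let $k\ge 2$, let $\Sigma$ be an alphabet of $k$ symbols with symbol codes $0,\dots,k-1$, let $\beta=k+1$, and let $\ulcorner\cdot\urcorner$ be the block-partition encoding, with $L(m)=\max\{\operatorname{digits}(\ulcorner s\urcorner): s\in\Sigma^m\}$. Then the block-partition encoding has asymptotically optimal code length: $L(m)=\Theta(m)$, and this matches the information-theoretic lower bound, namely for every injective map $f:\Sigma^m\to\mathbb{N}$ one has $\max\{\operatorname{digits}(f(s)):s\in\Sigma^m\}=\Omega(m)$, so $L(m)$ is within a constant factor (depending only on $k$) of the optimum over all injective maps.
   Context: $F_n$ is the Fibonacci sequence ($F_0=0$, $F_1=1$, $F_{n+2}=F_{n+1}+F_n$); $\operatorname{digits}(n)$ is the number of decimal digits of $n$. The block-partition encoding is $\ulcorner\varepsilon\urcorner=0$ and, for a nonempty string $s=s_1\cdots s_m$ with symbol codes $c_1,\dots,c_m\in\{0,\dots,k-1\}$, $\ulcorner s\urcorner=\sum_{i=0}^{m-1}F_{2+i\beta+c_{i+1}}$. Asymptotics are as $m\to\infty$ with $k$ fixed. -}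

module Defs where

open import Data.Nat using (ℕ; zero; suc; _+_; _*_; _⊔_; _<ᵇ_)
open import Data.Nat.DivMod using (_/_)
open import Data.Bool using (if_then_else_)
open import Data.Fin using (Fin; toℕ)
open import Data.Vec using (Vec; []; _∷_)
open import Data.List using (List; []; _∷_; map; concatMap; foldr)
open import Data.List using () renaming ([_] to singleton)
open import Data.Fin using () renaming (zero to fz)
open import Data.List.Base using ()
open import Data.Fin.Base using ()

fib : ℕ → ℕ
fib zero = 0
fib (suc zero) = 1
fib (suc (suc n)) = fib (suc n) + fib n

-- number of decimal digits (digits 0 = 1); fuel n suffices since n / 10 < n
digitsAux : ℕ → ℕ → ℕ
digitsAux zero n = 1
digitsAux (suc fuel) n = if n <ᵇ 10 then 1 else suc (digitsAux fuel (n / 10))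

digits : ℕ → ℕ
digits n = digitsAux n n

β : ℕ → ℕ
β k = suc k

encodeFrom : (k : ℕ) {m : ℕ} → ℕ → Vec (Fin k) m → ℕ
encodeFrom k i [] = 0
encodeFrom k i (c ∷ s) = fib (2 + i * β k + toℕ c) + encodeFrom k (suc i) s

encode : (k : ℕ) {m : ℕ} → Vec (Fin k) m → ℕ
encode k s = encodeFrom k 0 s

allFinList : (k : ℕ) → List (Fin k)
allFinList zero = []
allFinList (suc k) = fz ∷ map Data.Fin.suc (allFinList k)

allVecs : (k m : ℕ) → List (Vec (Fin k) m)
allVecs k zero = singleton []
allVecs k (suc m) = concatMap (λ c → map (c ∷_) (allVecs k m)) (allFinList k)

maxDigits : (k m : ℕ) → (Vec (Fin k) m → ℕ) → ℕ
maxDigits k m f = foldr _⊔_ 0 (map (λ s → digits (f s)) (allVecs k m))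

L : ℕ → ℕ → ℕ
L k m = maxDigits k m (encode k)

{-# OPTIONS --safe #-}
-- The block-partition code of a string of length m is a sum of Fibonacci numbers, one from each
-- block of β consecutive indices, never two adjacent ones; as in Zeckendorf's theorem the sum
-- stays below the first Fibonacci number after the last block, F(1 + mβ) ≤ 2^(mβ), so it has
-- at most mβ digits. Conversely the last summand is at least F(2 + 2(m-1)) ≥ 2^(m-1).
-- For an arbitrary injective f the k^m ≥ 2^m strings need distinct values below 10^D, where D
-- is the largest digit count; since 10 ≤ 2^4 this forces m ≤ 4D, and likewise m ≤ 4 L(m).
module Submission where

open import Defs
open import Data.Nat using (ℕ; zero; suc; _+_; _*_; _^_; _⊔_; _<ᵇ_; _≤_; _<_; _≥_; _≤′_; ≤′-reflexive; ≤′-step; z≤n; s≤s; NonZero; >-nonZero)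
open import Data.Nat.Properties
open import Data.Nat.DivMod using (_/_; _%_; m≡m%n+[m/n]*n; m%n<n; m/n<m; m<n*o⇒m/o<n)
open import Data.Bool using (true; false; T)
open import Data.Unit using (tt)
open import Data.Empty using (⊥-elim)
open import Data.Fin using (Fin; toℕ; fromℕ<; finToFun; funToFin; combine) renaming (zero to fz; suc to fs)
open import Data.Fin.Properties using (injective⇒≤; funToFin-finToFin; fromℕ<-injective; toℕ<n)
open import Data.Vec using (Vec; []; _∷_; replicate; tabulate; lookup)
open import Data.Vec.Properties using (lookup∘tabulate)
open import Data.List using ([]; _∷_; map; foldr)
open import Data.List.Membership.Propositional using (_∈_)
open import Data.List.Membership.Propositional.Properties using (∈-map⁺; ∈-concatMap⁺)
open import Data.List.Relation.Unary.Any using (here; there)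
import Data.List.Relation.Unary.Any as Any
open import Data.Product using (_×_; _,_; ∃-syntax)
open import Relation.Binary.PropositionalEquality using (_≡_; _≗_; refl; sym; trans; cong; cong₂; subst; module ≡-Reasoning)
open import Function using (_∘_)
open import Function.Definitions using (Injective)

m/n<o⇒m<o*n : ∀ {m n o} .{{_ : NonZero n}} → m / n < o → m < o * n
m/n<o⇒m<o*n {m} {n} {o} m/n<o = begin-strict
  m                   ≡⟨ m≡m%n+[m/n]*n m n ⟩
  m % n + m / n * n   <⟨ +-monoˡ-< (m / n * n) (m%n<n m n) ⟩
  suc (m / n) * n     ≤⟨ *-monoˡ-≤ n m/n<o ⟩
  o * n               ∎
  where open ≤-Reasoning

^-cancelʳ-≤ : ∀ b {m n} → 1 < b → b ^ m ≤ b ^ n → m ≤ n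
^-cancelʳ-≤ b 1<b bᵐ≤bⁿ = ≮⇒≥ (λ n<m → <⇒≱ (^-monoʳ-< b 1<b n<m) bᵐ≤bⁿ)

^-cancelʳ-< : ∀ b .{{_ : NonZero b}} {m n} → b ^ m < b ^ n → m < n
^-cancelʳ-< b bᵐ<bⁿ = ≰⇒> (λ n≤m → <⇒≱ bᵐ<bⁿ (^-monoʳ-≤ b n≤m))

10^d≤2^[4*d] : ∀ d → 10 ^ d ≤ 2 ^ (4 * d)
10^d≤2^[4*d] d = ≤-trans (^-monoˡ-≤ d (m≤m+n 10 6)) (≤-reflexive (^-*-assoc 2 4 d))

digitsAux-< : ∀ fuel n → n ≤ fuel → n < 10 ^ digitsAux fuel n
digitsAux-< zero zero z≤n = s≤s z≤n
digitsAux-< (suc fuel) n n≤1+fuel with n <ᵇ 10 in eq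
... | true  = <ᵇ⇒< n 10 (subst T (sym eq) tt)
... | false = subst (n <_) (*-comm (10 ^ digitsAux fuel (n / 10)) 10)
                (m/n<o⇒m<o*n (digitsAux-< fuel (n / 10) n/10≤fuel))
  where
  10≤n : 10 ≤ n
  10≤n = ≮⇒≥ (λ n<10 → subst T eq (<⇒<ᵇ n<10))
  n/10≤fuel : n / 10 ≤ fuel
  n/10≤fuel = ≤-pred (≤-trans (m/n<m n 10 {{>-nonZero (≤-trans (s≤s z≤n) 10≤n)}} (s≤s (s≤s z≤n))) n≤1+fuel)

n<10^digits[n] : ∀ n → n < 10 ^ digits n
n<10^digits[n] n = digitsAux-< n n ≤-refl

digitsAux-≤ : ∀ fuel {n} d → n < 10 ^ suc d → digitsAux fuel n ≤ suc d
digitsAux-≤ zero d _ = s≤s z≤n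
digitsAux-≤ (suc fuel) {n} d n<10^d with n <ᵇ 10 in eq
digitsAux-≤ (suc fuel) d       n<10^d | true  = s≤s z≤n
digitsAux-≤ (suc fuel) zero    n<10   | false = ⊥-elim (subst T eq (<⇒<ᵇ n<10))
digitsAux-≤ (suc fuel) {n} (suc d) n<10^d | false =
  s≤s (digitsAux-≤ fuel d (m<n*o⇒m/o<n (subst (n <_) (*-comm 10 (10 ^ suc d)) n<10^d)))

digits-≤ : ∀ {n} d → n < 10 ^ suc d → digits n ≤ suc d
digits-≤ {n} = digitsAux-≤ n

2^n≤m⇒n<4*digits[m] : ∀ {n m} → 2 ^ n ≤ m → n < 4 * digits m
2^n≤m⇒n<4*digits[m] {n} {m} 2ⁿ≤m = ^-cancelʳ-< 2 (begin-strict
  2 ^ n                ≤⟨ 2ⁿ≤m ⟩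
  m                    <⟨ n<10^digits[n] m ⟩
  10 ^ digits m        ≤⟨ 10^d≤2^[4*d] (digits m) ⟩
  2 ^ (4 * digits m)   ∎)
  where open ≤-Reasoning

2^n≤10^d⇒n≤4*d : ∀ {n} d → 2 ^ n ≤ 10 ^ d → n ≤ 4 * d
2^n≤10^d⇒n≤4*d d 2ⁿ≤10ᵈ = ^-cancelʳ-≤ 2 (s≤s (s≤s z≤n)) (≤-trans 2ⁿ≤10ᵈ (10^d≤2^[4*d] d))

foldr-⊔-upper : ∀ {x} xs → x ∈ xs → x ≤ foldr _⊔_ 0 xs
foldr-⊔-upper (y ∷ xs) (here refl) = m≤m⊔n y _
foldr-⊔-upper (y ∷ xs) (there x∈xs) = ≤-trans (foldr-⊔-upper xs x∈xs) (m≤n⊔m y _)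

foldr-⊔-map-lub : ∀ {A : Set} (g : A → ℕ) xs {D} → (∀ x → g x ≤ D) → foldr _⊔_ 0 (map g xs) ≤ D
foldr-⊔-map-lub g []       g≤D = z≤n
foldr-⊔-map-lub g (x ∷ xs) g≤D = ⊔-lub (g≤D x) (foldr-⊔-map-lub g xs g≤D)

∈-allFinList : ∀ {k} (c : Fin k) → c ∈ allFinList k
∈-allFinList fz     = here refl
∈-allFinList (fs c) = there (∈-map⁺ fs (∈-allFinList c))

∈-allVecs : ∀ {k m} (s : Vec (Fin k) m) → s ∈ allVecs k m
∈-allVecs []      = here refl
∈-allVecs {k} {suc m} (c ∷ s) = ∈-concatMap⁺ (λ c′ → map (c′ ∷_) (allVecs k m))
  (Any.map (λ { refl → ∈-map⁺ (c ∷_) (∈-allVecs s) }) (∈-allFinList c))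

digits≤maxDigits : ∀ {k m} (f : Vec (Fin k) m → ℕ) s → digits (f s) ≤ maxDigits k m f
digits≤maxDigits f s = foldr-⊔-upper _ (∈-map⁺ (digits ∘ f) (∈-allVecs s))

maxDigits-lub : ∀ {k m} (f : Vec (Fin k) m → ℕ) {D} → (∀ s → digits (f s) ≤ D) → maxDigits k m f ≤ D
maxDigits-lub {k} {m} f = foldr-⊔-map-lub (digits ∘ f) (allVecs k m)

fib-≤-suc : ∀ n → fib n ≤ fib (suc n)
fib-≤-suc zero          = z≤n
fib-≤-suc (suc zero)    = ≤-refl
fib-≤-suc (suc (suc n)) = m≤m+n _ _

fib-mono-≤ : ∀ {m n} → m ≤ n → fib m ≤ fib n
fib-mono-≤ = mono′ ∘ ≤⇒≤′
  where
  mono′ : ∀ {m n} → m ≤′ n → fib m ≤ fib n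
  mono′ (≤′-reflexive refl) = ≤-refl
  mono′ (≤′-step {n} m≤′n)  = ≤-trans (mono′ m≤′n) (fib-≤-suc n)

fib[1+n]≤2^n : ∀ n → fib (suc n) ≤ 2 ^ n
fib[1+n]≤2^n zero          = ≤-refl
fib[1+n]≤2^n (suc zero)    = s≤s z≤n
fib[1+n]≤2^n (suc (suc n)) = +-mono-≤ (fib[1+n]≤2^n (suc n))
  (≤-trans (fib[1+n]≤2^n n) (≤-trans (^-monoʳ-≤ 2 (n≤1+n n)) (m≤m+n _ 0)))

2*fib[n]≤fib[2+n] : ∀ n → 2 * fib n ≤ fib (2 + n)
2*fib[n]≤fib[2+n] n = +-mono-≤ (fib-≤-suc n) (≤-reflexive (*-identityˡ (fib n)))

2^n≤fib[2+n*2] : ∀ n → 2 ^ n ≤ fib (2 + n * 2)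
2^n≤fib[2+n*2] zero    = ≤-refl
2^n≤fib[2+n*2] (suc n) = ≤-trans (*-monoʳ-≤ 2 (2^n≤fib[2+n*2] n)) (2*fib[n]≤fib[2+n] (2 + n * 2))

fib[2+iβ+c]+fib[1+iβ]≤fib[1+[1+i]β] : ∀ k i (c : Fin k) → fib (2 + i * β k + toℕ c) + fib (suc (i * β k)) ≤ fib (suc (suc i * β k))
fib[2+iβ+c]+fib[1+iβ]≤fib[1+[1+i]β] k i c = begin
  fib (2 + i * β k + toℕ c) + fib (suc (i * β k))
    ≤⟨ +-monoʳ-≤ (fib (2 + i * β k + toℕ c)) (fib-mono-≤ (s≤s (m≤m+n (i * β k) (toℕ c)))) ⟩
  fib (3 + i * β k + toℕ c)
    ≤⟨ fib-mono-≤ (s≤s (s≤s c+iβ<k+iβ)) ⟩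
  fib (suc (suc i * β k))
    ∎
  where
  open ≤-Reasoning
  c+iβ<k+iβ : suc (i * β k + toℕ c) ≤ k + i * β k
  c+iβ<k+iβ = subst (_≤ k + i * β k) (cong suc (+-comm (toℕ c) (i * β k))) (+-monoˡ-≤ (i * β k) (toℕ<n c))

encodeFrom+fib≤fib : ∀ k {m} i (s : Vec (Fin k) m) →
                     encodeFrom k i s + fib (suc (i * β k)) ≤ fib (suc ((i + m) * β k))
encodeFrom+fib≤fib k i [] = ≤-reflexive (cong (λ j → fib (suc (j * β k))) (sym (+-identityʳ i)))
encodeFrom+fib≤fib k {suc m} i (c ∷ s) = begin
  fib (2 + i * β k + toℕ c) + encodeFrom k (suc i) s + fib (suc (i * β k))
    ≡⟨ trans (cong (_+ fib (suc (i * β k))) (+-comm (fib (2 + i * β k + toℕ c)) _))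
             (+-assoc (encodeFrom k (suc i) s) _ _) ⟩
  encodeFrom k (suc i) s + (fib (2 + i * β k + toℕ c) + fib (suc (i * β k)))
    ≤⟨ +-monoʳ-≤ (encodeFrom k (suc i) s) (fib[2+iβ+c]+fib[1+iβ]≤fib[1+[1+i]β] k i c) ⟩
  encodeFrom k (suc i) s + fib (suc (suc i * β k))
    ≤⟨ encodeFrom+fib≤fib k (suc i) s ⟩
  fib (suc ((suc i + m) * β k))
    ≡⟨ cong (λ j → fib (suc (j * β k))) (sym (+-suc i m)) ⟩
  fib (suc ((i + suc m) * β k))
    ∎
  where open ≤-Reasoning

encode<fib : ∀ k {m} (s : Vec (Fin k) m) → encode k s < fib (suc (m * β k))
encode<fib k {m} s = subst (_≤ fib (suc (m * β k))) (+-comm (encode k s) 1) (encodeFrom+fib≤fib k 0 s)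

fib≤encodeFrom : ∀ k i n (s : Vec (Fin k) (suc n)) → fib (2 + (i + n) * β k) ≤ encodeFrom k i s
fib≤encodeFrom k i zero (c ∷ []) rewrite +-identityʳ i =
  ≤-trans (fib-mono-≤ (m≤m+n (2 + i * β k) (toℕ c))) (m≤m+n _ 0)
fib≤encodeFrom k i (suc n) (c ∷ s) rewrite +-suc i n =
  ≤-trans (fib≤encodeFrom k (suc i) n s) (m≤n+m _ _)

L≤β*m : ∀ k n → L k (suc n) ≤ β k * suc n
L≤β*m k n = maxDigits-lub (encode k) λ s →
  ≤-trans (digits-≤ (k + n * β k) (encode<10^mβ s)) (≤-reflexive (*-comm (suc n) (β k)))
  where
  open ≤-Reasoning
  encode<10^mβ : (s : Vec (Fin k) (suc n)) → encode k s < 10 ^ (suc n * β k)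
  encode<10^mβ s = begin-strict
    encode k s                <⟨ encode<fib k s ⟩
    fib (suc (suc n * β k))   ≤⟨ fib[1+n]≤2^n (suc n * β k) ⟩
    2 ^ (suc n * β k)         ≤⟨ ^-monoˡ-≤ (suc n * β k) (m≤m+n 2 8) ⟩
    10 ^ (suc n * β k)        ∎

m≤4*L : ∀ k n → suc n ≤ 4 * L (suc k) (suc n)
m≤4*L k n = ≤-trans (2^n≤m⇒n<4*digits[m] 2ⁿ≤encode) (*-monoʳ-≤ 4 (digits≤maxDigits (encode (suc k)) s))
  where
  open ≤-Reasoning
  s : Vec (Fin (suc k)) (suc n)
  s = replicate (suc n) fz
  2ⁿ≤encode : 2 ^ n ≤ encode (suc k) s
  2ⁿ≤encode = begin
    2 ^ n                      ≤⟨ 2^n≤fib[2+n*2] n ⟩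
    fib (2 + n * 2)            ≤⟨ fib-mono-≤ (+-monoʳ-≤ 2 (*-monoʳ-≤ n (s≤s (s≤s z≤n)))) ⟩
    fib (2 + n * β (suc k))    ≤⟨ fib≤encodeFrom (suc k) 0 n s ⟩
    encode (suc k) s           ∎

funToFin-cong : ∀ {m n} {f g : Fin m → Fin n} → f ≗ g → funToFin f ≡ funToFin g
funToFin-cong {zero}  f≗g = refl
funToFin-cong {suc m} f≗g = cong₂ combine (f≗g fz) (funToFin-cong (f≗g ∘ fs))

tabulate∘finToFun-injective : ∀ {k m} → Injective _≡_ _≡_ (tabulate ∘ finToFun {k} {m})
tabulate∘finToFun-injective {k} {m} {x} {y} eq = begin
  x                                ≡⟨ sym (funToFin-finToFin {m} {k} x) ⟩
  funToFin (finToFun {k} {m} x)    ≡⟨ funToFin-cong finToFun-x≗y ⟩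
  funToFin (finToFun {k} {m} y)    ≡⟨ funToFin-finToFin {m} {k} y ⟩
  y                                ∎
  where
  open ≡-Reasoning
  finToFun-x≗y : finToFun x ≗ finToFun y
  finToFun-x≗y i = trans (sym (lookup∘tabulate (finToFun x) i))
                     (trans (cong (λ v → lookup v i) eq) (lookup∘tabulate (finToFun y) i))

injective⇒^≤ : ∀ {k m n} {f : Vec (Fin k) m → Fin n} → Injective _≡_ _≡_ f → k ^ m ≤ n
injective⇒^≤ f-inj = injective⇒≤ (tabulate∘finToFun-injective ∘ f-inj)

m≤4*maxDigits : ∀ {k m} → 2 ≤ k → (f : Vec (Fin k) m → ℕ) → Injective _≡_ _≡_ f → m ≤ 4 * maxDigits k m f
m≤4*maxDigits {k} {m} 2≤k f f-inj = 2^n≤10^d⇒n≤4*d D (≤-trans (^-monoˡ-≤ m 2≤k) kᵐ≤10ᴰ)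
  where
  D = maxDigits k m f
  f<10ᴰ : ∀ s → f s < 10 ^ D
  f<10ᴰ s = <-≤-trans (n<10^digits[n] (f s)) (^-monoʳ-≤ 10 (digits≤maxDigits f s))
  kᵐ≤10ᴰ : k ^ m ≤ 10 ^ D
  kᵐ≤10ᴰ = injective⇒^≤ {f = λ s → fromℕ< (f<10ᴰ s)}
             (λ {x} {y} → f-inj ∘ fromℕ<-injective (f x) (f y) (f<10ᴰ x) (f<10ᴰ y))

L≤[β*4]*maxDigits : ∀ {k n} → 2 ≤ k → (f : Vec (Fin k) (suc n) → ℕ) → Injective _≡_ _≡_ f →
                    L k (suc n) ≤ β k * 4 * maxDigits k (suc n) f
L≤[β*4]*maxDigits {k} {n} 2≤k f f-inj = begin
  L k (suc n)                       ≤⟨ L≤β*m k n ⟩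
  β k * suc n                       ≤⟨ *-monoʳ-≤ (β k) (m≤4*maxDigits 2≤k f f-inj) ⟩
  β k * (4 * maxDigits k (suc n) f) ≡⟨ *-assoc (β k) 4 (maxDigits k (suc n) f) ⟨
  β k * 4 * maxDigits k (suc n) f   ∎
  where open ≤-Reasoning

theorem5p2 : (k : ℕ) → 2 ≤ k →
    -- L(m) = Θ(m)
    (∃[ a ] ∃[ b ] ∃[ C ] ∃[ M ] (1 ≤ a × 1 ≤ b ×
      (∀ m → m ≥ M → a * m ≤ b * L k m × L k m ≤ C * m)))
    -- every injective f : Σ^m → ℕ has max digits = Ω(m)
    × (∃[ a ] ∃[ b ] ∃[ M ] (1 ≤ a × 1 ≤ b ×
      (∀ m → m ≥ M → (f : Vec (Fin k) m → ℕ) → Injective _≡_ _≡_ f →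
        a * m ≤ b * maxDigits k m f)))
    -- L(m) within a constant factor of the optimum over injective maps
    × (∃[ C ] ∃[ M ] (∀ m → m ≥ M → (f : Vec (Fin k) m → ℕ) → Injective _≡_ _≡_ f →
        L k m ≤ C * maxDigits k m f))
theorem5p2 (suc k) 2≤k =
    (1 , 4 , β (suc k) , 1 , ≤-refl , s≤s z≤n ,
      λ { (suc n) _ → 1*m≤ (m≤4*L k n) , L≤β*m (suc k) n })
  , (1 , 4 , 0 , ≤-refl , s≤s z≤n ,
      λ m _ f f-inj → 1*m≤ (m≤4*maxDigits 2≤k f f-inj))
  , (β (suc k) * 4 , 1 , λ { (suc n) _ f f-inj → L≤[β*4]*maxDigits 2≤k f f-inj })
  where
  1*m≤ : ∀ {m n} → m ≤ n → 1 * m ≤ n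
  1*m≤ {m} = ≤-trans (≤-reflexive (*-identityˡ m))
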